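{- The set of cancellative elements of $\mathcal P_{\mathrm{fin}}(\mathbb N_0)$ is $\{\{k\}\colon k\in\mathbb N_0\}$. Moreover, for every $A\in\mathcal P_{\mathrm{fin}}(\mathbb N_0)$ with $|A|\ge 2$, $A$ is not cancellative in $[\![A]\!]$, i.e., there exist $B,C\in[\![A]\!]$ with $B\ne C$ and $A+B=A+C$.
   Context: $\mathcal P_{\mathrm{fin}}(\mathbb N_0)$ is the monoid of all finite nonempty subsets of $\mathbb N_0$ under set addition $A+B=\{a+b\colon a\in A,b\in B\}$ (identity $\{0\}$). An element $A$ of a monoid $M$ is cancellative (in $M$) if $A+B=A+C$ with $B,C\in M$ implies $B=C$. In $\mathcal P_{\mathrm{fin}}(\mathbb N_0)$, $B$ divides $D$ if $D=B+C$ for some $C\in\mathcal P_{\mathrm{fin}}(\mathbb N_0)$, and $[\![A]\!]=\{B\in\mathcal P_{\mathrm{fin}}(\mathbb N_0)\colon B \text{ divides } nA \text{ for some } n\in\mathbb N_0\}$ is the smallest divisor-closed submonoid containing $A$, where $nA=A+\dots+A$ ($n$ summands) and $0A=\{0\}$. -}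

module Defs where

open import Data.Nat using (ℕ; zero; suc; _+_)
open import Data.List.NonEmpty using (List⁺; [_]; toList)
import Data.List.NonEmpty as L⁺
open import Data.List.Membership.Propositional using (_∈_)
open import Data.Product using (Σ; ∃; _×_)
open import Function.Bundles using (_⇔_)

-- An element of P_fin(ℕ₀): a finite nonempty subset of ℕ, represented by a
-- nonempty list of its elements (order and repetitions are irrelevant).
Pfin : Set
Pfin = List⁺ ℕ

_∈ₛ_ : ℕ → Pfin → Set
x ∈ₛ A = x ∈ toList A

_≈_ : Pfin → Pfin → Set
A ≈ B = ∀ x → (x ∈ₛ A) ⇔ (x ∈ₛ B)

_⊕_ : Pfin → Pfin → Pfin
A ⊕ B = L⁺.concatMap (λ a → L⁺.map (a +_) B) A

infixl 6 _⊕_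

𝟘 : Pfin
𝟘 = [ 0 ]

_·_ : ℕ → Pfin → Pfin
zero  · A = 𝟘
suc n · A = A ⊕ (n · A)

_∣ₛ_ : Pfin → Pfin → Set
B ∣ₛ D = Σ Pfin (λ C → D ≈ (B ⊕ C))

-- membership in [[A]], the smallest divisor-closed submonoid containing A
_∈⟦_⟧ : Pfin → Pfin → Set
B ∈⟦ A ⟧ = ∃ (λ n → B ∣ₛ (n · A))

Cancellative : Pfin → Set
Cancellative A = ∀ B C → (A ⊕ B) ≈ (A ⊕ C) → B ≈ C

CancellativeIn⟦⟧ : Pfin → Set
CancellativeIn⟦⟧ A = ∀ B C → B ∈⟦ A ⟧ → C ∈⟦ A ⟧ → (A ⊕ B) ≈ (A ⊕ C) → B ≈ C

{-# OPTIONS --safe #-}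
module Submission where

-- If a, b are distinct elements of A, then removing a + b from 2A does not
-- change A + 2A: every c + (a + b) with c ∈ A is also b + (a + c) when c ≠ b,
-- and a + (b + b) when c = b. Hence B = 2A ∖ {a + b} and C = 2A are distinct
-- elements of [[A]] with A + B = A + C = 3A. Conversely a singleton {k} is
-- cancellative, since k + x ∈ {k} + B holds exactly when x ∈ B.

open import Defs
import Algebra.Properties.CommutativeSemigroup as CommutativeSemigroupProperties
open import Data.Nat using (ℕ; _+_; _≟_)
open import Data.Nat.Properties
  using (+-identityʳ; +-comm; +-cancelˡ-≡; +-cancelʳ-≡; +-commutativeSemigroup)
open import Data.List.NonEmpty using ([_]; _∷_; toList)
import Data.List.NonEmpty as List⁺
open import Data.List as List using ([]; _∷_; _++_; filter; cartesianProductWith)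
open import Data.List.Relation.Unary.Any using (here; there)
open import Data.List.Membership.Propositional using (_∈_)
open import Data.List.Membership.Propositional.Properties
  using (∈-cartesianProductWith⁺; ∈-cartesianProductWith⁻; ∈-filter⁺; ∈-filter⁻)
open import Data.Product using (Σ; ∃; ∃₂; _×_; _,_; proj₁; proj₂)
open import Data.Empty using (⊥-elim)
open import Relation.Nullary using (¬_; yes; no; ¬?)
open import Relation.Binary.PropositionalEquality
  using (_≢_; _≡_; refl; sym; cong; subst)
open import Function using (_∘_)
open import Function.Bundles using (_⇔_; mk⇔; Equivalence)
import Function.Properties.Equivalence as ⇔

open Equivalence using (to; from)
open CommutativeSemigroupProperties +-commutativeSemigroup using (x∙yz≈y∙xz; x∙yz≈z∙yx)

infix 4 _⊆ₛ_

_⊆ₛ_ : Pfin → Pfin → Set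
A ⊆ₛ B = ∀ {x} → x ∈ₛ A → x ∈ₛ B

⊆-antisym : ∀ {A B} → A ⊆ₛ B → B ⊆ₛ A → A ≈ B
⊆-antisym A⊆B B⊆A x = mk⇔ A⊆B B⊆A

≈-sym : ∀ {A B} → A ≈ B → B ≈ A
≈-sym A≈B x = ⇔.sym (A≈B x)

toList-⊕ : ∀ A B → toList (A ⊕ B) ≡ cartesianProductWith _+_ (toList A) (toList B)
toList-⊕ (a ∷ as) (b ∷ bs) = cong (λ xs → a + b ∷ List.map (a +_) bs ++ xs) (concat-sums as)
  where
  concat-sums : ∀ cs →
                List.concat (List.map toList (List.map (λ c → List⁺.map (c +_) (b ∷ bs)) cs))
                ≡ cartesianProductWith _+_ cs (b ∷ bs)
  concat-sums []       = refl
  concat-sums (c ∷ cs) = cong (List.map (c +_) (b ∷ bs) ++_) (concat-sums cs)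

∈-⊕⁺ : ∀ {A B a b} → a ∈ₛ A → b ∈ₛ B → (a + b) ∈ₛ (A ⊕ B)
∈-⊕⁺ {A} {B} {a} {b} a∈A b∈B =
  subst ((a + b) ∈_) (sym (toList-⊕ A B)) (∈-cartesianProductWith⁺ _+_ a∈A b∈B)

∈-⊕⁻ : ∀ A B {x} → x ∈ₛ (A ⊕ B) → ∃₂ λ a b → a ∈ₛ A × b ∈ₛ B × x ≡ a + b
∈-⊕⁻ A B {x} x∈A⊕B =
  ∈-cartesianProductWith⁻ _+_ (toList A) (toList B) (subst (x ∈_) (toList-⊕ A B) x∈A⊕B)

⊕-monoʳ-⊆ : ∀ A {B C} → B ⊆ₛ C → A ⊕ B ⊆ₛ A ⊕ C
⊕-monoʳ-⊆ A {B} B⊆C x∈A⊕B with ∈-⊕⁻ A B x∈A⊕B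
... | a , b , a∈A , b∈B , refl = ∈-⊕⁺ {A} a∈A (B⊆C b∈B)

⊕-comm-⊆ : ∀ A B → A ⊕ B ⊆ₛ B ⊕ A
⊕-comm-⊆ A B x∈A⊕B with ∈-⊕⁻ A B x∈A⊕B
... | a , b , a∈A , b∈B , refl = subst (_∈ₛ (B ⊕ A)) (+-comm b a) (∈-⊕⁺ {B} b∈B a∈A)

⊕-identityʳ : ∀ A → (A ⊕ 𝟘) ≈ A
⊕-identityʳ A = ⊆-antisym drop-zero add-zero
  where
  drop-zero : A ⊕ 𝟘 ⊆ₛ A
  drop-zero x∈A⊕𝟘 with ∈-⊕⁻ A 𝟘 x∈A⊕𝟘
  ... | a , .0 , a∈A , here refl , refl = subst (_∈ₛ A) (sym (+-identityʳ a)) a∈A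
  add-zero : A ⊆ₛ A ⊕ 𝟘
  add-zero {x} x∈A = subst (_∈ₛ (A ⊕ 𝟘)) (+-identityʳ x) (∈-⊕⁺ {A} {𝟘} x∈A (here refl))

∈-2·⁺ : ∀ {A a b} → a ∈ₛ A → b ∈ₛ A → (a + b) ∈ₛ (2 · A)
∈-2·⁺ {A} a∈A b∈A = ∈-⊕⁺ {A} a∈A (from (⊕-identityʳ A _) b∈A)

multiple-∈⟦⟧ : ∀ n A → (n · A) ∈⟦ A ⟧
multiple-∈⟦⟧ n A = n , 𝟘 , ≈-sym (⊕-identityʳ (n · A))

-- A ∖ {x}, kept nonempty by an element y of A different from x.
remove : ℕ → Pfin → ℕ → Pfin
remove x A y = y ∷ filter (λ z → ¬? (z ≟ x)) (toList A)

module _ {x A y} (y∈A : y ∈ₛ A) (y≢x : y ≢ x) where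

  ∈-remove⁺ : ∀ {z} → z ∈ₛ A → z ≢ x → z ∈ₛ remove x A y
  ∈-remove⁺ z∈A z≢x = there (∈-filter⁺ (λ z → ¬? (z ≟ x)) z∈A z≢x)

  ∈-remove⁻ : ∀ {z} → z ∈ₛ remove x A y → z ∈ₛ A × z ≢ x
  ∈-remove⁻ (here refl) = y∈A , y≢x
  ∈-remove⁻ (there z∈A∖x) = ∈-filter⁻ (λ z → ¬? (z ≟ x)) {xs = toList A} z∈A∖x

module NonCancellation {A a b} (a∈A : a ∈ₛ A) (b∈A : b ∈ₛ A) (a≢b : a ≢ b) where

  a+a≢a+b : a + a ≢ a + b
  a+a≢a+b = a≢b ∘ +-cancelˡ-≡ a a b

  2A∖[a+b] : Pfin
  2A∖[a+b] = remove (a + b) (2 · A) (a + a)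

  ∈-2A∖[a+b]⁺ : ∀ {z} → z ∈ₛ (2 · A) → z ≢ a + b → z ∈ₛ 2A∖[a+b]
  ∈-2A∖[a+b]⁺ = ∈-remove⁺ (∈-2·⁺ a∈A a∈A) a+a≢a+b

  2A∖[a+b]⊆2A : 2A∖[a+b] ⊆ₛ 2 · A
  2A∖[a+b]⊆2A = proj₁ ∘ ∈-remove⁻ (∈-2·⁺ a∈A a∈A) a+a≢a+b

  a+b-absorbed : ∀ {c} → c ∈ₛ A → (c + (a + b)) ∈ₛ (A ⊕ 2A∖[a+b])
  a+b-absorbed {c} c∈A with c ≟ b
  ... | yes refl =
    subst (_∈ₛ (A ⊕ 2A∖[a+b])) (sym (x∙yz≈y∙xz c a c))
          (∈-⊕⁺ {A} a∈A (∈-2A∖[a+b]⁺ (∈-2·⁺ c∈A c∈A) (a≢b ∘ sym ∘ +-cancelʳ-≡ c c a)))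
  ... | no c≢b =
    subst (_∈ₛ (A ⊕ 2A∖[a+b])) (sym (x∙yz≈z∙yx c a b))
          (∈-⊕⁺ {A} b∈A (∈-2A∖[a+b]⁺ (∈-2·⁺ a∈A c∈A) (c≢b ∘ +-cancelˡ-≡ a c b)))

  A⊕2A⊆A⊕2A∖[a+b] : A ⊕ 2 · A ⊆ₛ A ⊕ 2A∖[a+b]
  A⊕2A⊆A⊕2A∖[a+b] x∈A⊕2A with ∈-⊕⁻ A (2 · A) x∈A⊕2A
  ... | c , z , c∈A , z∈2A , refl with z ≟ a + b
  ...   | yes refl = a+b-absorbed c∈A
  ...   | no z≢a+b = ∈-⊕⁺ {A} c∈A (∈-2A∖[a+b]⁺ z∈2A z≢a+b)

  A⊕2A∖[a+b]≈A⊕2A : (A ⊕ 2A∖[a+b]) ≈ (A ⊕ 2 · A)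
  A⊕2A∖[a+b]≈A⊕2A = ⊆-antisym (⊕-monoʳ-⊆ A 2A∖[a+b]⊆2A) A⊕2A⊆A⊕2A∖[a+b]

  2A∖[a+b]∈⟦A⟧ : 2A∖[a+b] ∈⟦ A ⟧
  2A∖[a+b]∈⟦A⟧ = 3 , A , ⊆-antisym (⊕-comm-⊆ A 2A∖[a+b] ∘ A⊕2A⊆A⊕2A∖[a+b])
                                    (⊕-monoʳ-⊆ A 2A∖[a+b]⊆2A ∘ ⊕-comm-⊆ 2A∖[a+b] A)

  2A∖[a+b]≉2A : ¬ (2A∖[a+b] ≈ (2 · A))
  2A∖[a+b]≉2A 2A∖[a+b]≈2A =
    proj₂ (∈-remove⁻ (∈-2·⁺ a∈A a∈A) a+a≢a+b (from (2A∖[a+b]≈2A (a + b)) (∈-2·⁺ a∈A b∈A)))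
          refl

NonCancellingPair : Pfin → Set
NonCancellingPair A = Σ Pfin λ B → Σ Pfin λ C →
  (B ∈⟦ A ⟧) × (C ∈⟦ A ⟧) × ¬ (B ≈ C) × ((A ⊕ B) ≈ (A ⊕ C))

noncancelling-pair : ∀ {A a b} → a ∈ₛ A → b ∈ₛ A → a ≢ b → NonCancellingPair A
noncancelling-pair {A} a∈A b∈A a≢b =
  2A∖[a+b] , 2 · A , 2A∖[a+b]∈⟦A⟧ , multiple-∈⟦⟧ 2 A , 2A∖[a+b]≉2A , A⊕2A∖[a+b]≈A⊕2A
  where open NonCancellation a∈A b∈A a≢b

noncancelling-pair⇒¬cancellativeIn⟦⟧ : ∀ {A} → NonCancellingPair A → ¬ CancellativeIn⟦⟧ A
noncancelling-pair⇒¬cancellativeIn⟦⟧ (B , C , B∈⟦A⟧ , C∈⟦A⟧ , B≉C , A⊕B≈A⊕C) cancel =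
  B≉C (cancel B C B∈⟦A⟧ C∈⟦A⟧ A⊕B≈A⊕C)

∈-⊕-singleton : ∀ {A k} B {x} → A ≈ [ k ] → x ∈ₛ B ⇔ (k + x) ∈ₛ (A ⊕ B)
∈-⊕-singleton {A} {k} B {x} A≈[k] = mk⇔ (∈-⊕⁺ {A} (from (A≈[k] k) (here refl))) shift-back
  where
  shift-back : (k + x) ∈ₛ (A ⊕ B) → x ∈ₛ B
  shift-back k+x∈A⊕B with ∈-⊕⁻ A B k+x∈A⊕B
  ... | a , b , a∈A , b∈B , k+x≡a+b with to (A≈[k] a) a∈A
  ...   | here refl = subst (_∈ₛ B) (sym (+-cancelˡ-≡ k x b k+x≡a+b)) b∈B

singleton⇒cancellative : ∀ {A k} → A ≈ [ k ] → Cancellative A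
singleton⇒cancellative {k = k} A≈[k] B C A⊕B≈A⊕C x =
  ⇔.trans (∈-⊕-singleton B A≈[k])
          (⇔.trans (A⊕B≈A⊕C (k + x)) (⇔.sym (∈-⊕-singleton C A≈[k])))

cancellative⇒singleton : ∀ A → Cancellative A → ∃ λ k → A ≈ [ k ]
cancellative⇒singleton (h ∷ t) cancel = h , ⊆-antisym ∈A⇒≡h (λ { (here refl) → here refl })
  where
  ∈A⇒≡h : h ∷ t ⊆ₛ [ h ]
  ∈A⇒≡h {x} x∈A with x ≟ h
  ... | yes refl = here refl
  ... | no x≢h = ⊥-elim (noncancelling-pair⇒¬cancellativeIn⟦⟧
                           (noncancelling-pair x∈A (here refl) x≢h)
                           (λ B C _ _ → cancel B C))

corollary4p2 :
    ((A : Pfin) → Cancellative A ⇔ ∃ (λ (k : ℕ) → A ≈ [ k ]))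
    × ((A : Pfin) → (Σ ℕ λ a → Σ ℕ λ b → (a ∈ₛ A) × (b ∈ₛ A) × (a ≢ b))
       → ¬ CancellativeIn⟦⟧ A
         × Σ Pfin (λ B → Σ Pfin (λ C →
             (B ∈⟦ A ⟧) × (C ∈⟦ A ⟧) × ¬ (B ≈ C) × ((A ⊕ B) ≈ (A ⊕ C)))))
corollary4p2 =
  (λ A → mk⇔ (cancellative⇒singleton A) (singleton⇒cancellative ∘ proj₂)) ,
  λ { A (a , b , a∈A , b∈A , a≢b) →
        let pair = noncancelling-pair a∈A b∈A a≢b
        in noncancelling-pair⇒¬cancellativeIn⟦⟧ pair , pair }
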